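{- Let $R=\mathcal{R}(d_R(t),h(t))$ and $S=\mathcal{R}(d_S(t),h(t))$ be two Riordan arrays with the same second series $h(t)$, such that $d_R(0)+d_S(0)\neq 0$, and let $d_{R+S}(t)=d_R(t)+d_S(t)$ (so $R+S=\mathcal{R}(d_{R+S}(t),h(t))$). Then $R$, $S$ and $R+S$ all have the same $A$-sequence, with generating function $A(t)=t/\bar h(t)$. Moreover, writing $Z_R,Z_S,Z_{R+S}$ for the $Z$-sequence generating functions of $R,S,R+S$, $$Z_{R+S}(t)=\frac{d_R(0)Z_R(t)+d_S(0)Z_S(t)-d_{R+S}(0)\,\bar h(t)Z_R(t)Z_S(t)}{d_{R+S}(0)-\bar h(t)d_R(0)Z_S(t)-\bar h(t)d_S(0)Z_R(t)},$$ equivalently $$Z_{R+S}(t)=\frac{[d_R(0)Z_R(t)+d_S(0)Z_S(t)]A(t)-t\,d_{R+S}(0)Z_R(t)Z_S(t)}{d_{R+S}(0)A(t)-t[d_R(0)Z_S(t)+d_S(0)Z_R(t)]};$$ also $$Z_{R+S}(h(t))=\frac{d_R(t)+d_S(t)-d_R(0)-d_S(0)}{t(d_R(t)+d_S(t))},$$ and $$Z_{R+S}(t)=\frac{d_R(\bar h(t))Z_R(t)+d_S(\bar h(t))Z_S(t)}{d_R(\bar h(t))+d_S(\bar h(t))}.$$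
   Context: For formal power series $d(t),h(t)$ with $d(0)\neq 0$, $h(0)=0$, $h'(0)\neq 0$, the Riordan array $\mathcal{R}(d(t),h(t))$ is the infinite lower triangular matrix whose $(n,k)$-entry ($n,k\ge 0$) is $[t^n]\,d(t)h(t)^k$. $\bar h(t)$ denotes the compositional inverse of $h(t)$, i.e. $h(\bar h(t))=t=\bar h(h(t))$. The $A$-sequence $(a_n)$ of $\mathcal{R}(d,h)$ is the sequence with $d_{r+1,c+1}=\sum_{i\ge 0}a_i d_{r,c+i}$ for all $r,c\ge 0$ (where $d_{n,k}$ are the entries); its generating function is $A(t)=t/\bar h(t)$. The $Z$-sequence $(z_n)$ is the sequence with $d_{r+1,0}=\sum_{i\ge0} z_i d_{r,i}$ for all $r\ge 0$; its generating function is $Z(t)=\dfrac{d(\bar h(t))-d(0)}{\bar h(t)\,d(\bar h(t))}$, equivalently $d(t)=d(0)/(1-tZ(h(t)))$. -}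

module Defs where

open import Level using (_⊔_)
open import Data.Nat using (ℕ; zero; suc; _∸_) renaming (_+_ to _+ℕ_)
open import Data.Product using (_×_; Σ)
open import Relation.Nullary using (¬_)
open import Algebra.Bundles using (CommutativeRing)

module FPS {c ℓ} (F : CommutativeRing c ℓ) where
  open CommutativeRing F public

  IsField : Set (c ⊔ ℓ)
  IsField = (¬ (0# ≈ 1#)) × (∀ x → ¬ (x ≈ 0#) → Σ Carrier λ y → x * y ≈ 1#)

  Series : Set c
  Series = ℕ → Carrier

  _≋_ : Series → Series → Set ℓ
  f ≋ g = ∀ n → f n ≈ g n

  Σ< : ℕ → (ℕ → Carrier) → Carrier
  Σ< zero    f = 0#
  Σ< (suc n) f = Σ< n f + f n

  const : Carrier → Series
  const a zero    = a
  const a (suc n) = 0#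

  X : Series
  X zero          = 0#
  X (suc zero)    = 1#
  X (suc (suc n)) = 0#

  _⊕_ : Series → Series → Series
  (f ⊕ g) n = f n + g n

  ⊝_ : Series → Series
  (⊝ f) n = - (f n)

  _⊖_ : Series → Series → Series
  f ⊖ g = f ⊕ (⊝ g)

  _·_ : Carrier → Series → Series
  (a · f) n = a * f n

  _⊛_ : Series → Series → Series
  (f ⊛ g) n = Σ< (suc n) λ i → f i * g (n ∸ i)

  infixl 7 _⊛_ _·_
  infixl 6 _⊕_ _⊖_
  infix 4 _≋_

  pow : Series → ℕ → Series
  pow f zero    = const 1#
  pow f (suc k) = f ⊛ pow f k

  -- composition f(g(t)); meaningful when g(0) = 0 (then [t^n] g^k = 0 for k > n)
  _∘ₛ_ : Series → Series → Series
  (f ∘ₛ g) n = Σ< (suc n) λ k → f k * pow g k n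

  IsCompInverse : Series → Series → Set ℓ
  IsCompInverse h hb = (hb 0 ≈ 0#) × ((h ∘ₛ hb) ≋ X) × ((hb ∘ₛ h) ≋ X)

  entry : Series → Series → ℕ → ℕ → Carrier
  entry d h n k = (d ⊛ pow h k) n

  IsRiordan : Series → Series → Set ℓ
  IsRiordan d h = (¬ (d 0 ≈ 0#)) × (h 0 ≈ 0#) × (¬ (h 1 ≈ 0#))

  -- a is an A-sequence of R(d,h):  d_{r+1,c+1} = Σ_{i≥0} a_i d_{r,c+i}
  -- (terms with i > r vanish since d_{r,c+i} = 0 for c+i > r, so the sum is truncated at i ≤ r)
  IsASeq : Series → Series → Series → Set ℓ
  IsASeq d h a = ∀ r c → entry d h (suc r) (suc c) ≈ Σ< (suc r) (λ i → a i * entry d h r (c +ℕ i))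

  -- z is a Z-sequence of R(d,h):  d_{r+1,0} = Σ_{i≥0} z_i d_{r,i}  (terms with i > r vanish)
  IsZSeq : Series → Series → Series → Set ℓ
  IsZSeq d h z = ∀ r → entry d h (suc r) 0 ≈ Σ< (suc r) (λ i → z i * entry d h r i)

-- The A-sequence
-- depends on h alone: A = (h / t) ∘ hb satisfies h = t · A(h) and A · hb = t, and the
-- fundamental theorem of Riordan arrays turns d hᵏ⁺¹ = t · A(h) · d hᵏ into the
-- A-recurrence.  Likewise a Z-sequence z of R(d,h) satisfies t · z(h) · d = d - d(0);
-- composing with hb gives z · hb · d(hb) = d(hb) - d(0).  Comparing these equations for
-- R, S and R+S shows hb · Z_{R+S} · (u + v) = hb · (u Z_R + v Z_S) with u = dR(hb),
-- v = dS(hb); hb is cancellable since hb'(0) is a unit, which gives the last formula.  The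
-- remaining ones are ring identities, after substituting dR(0) = u (1 - hb Z_R),
-- dS(0) = v (1 - hb Z_S) and t = A · hb.

module Submission where

open import Defs
open import Algebra.Bundles using (CommutativeRing; RawRing)
import Algebra.Properties.Ring as RingProperties
open import Algebra.Solver.Ring.AlmostCommutativeRing
  using (_-Raw-AlmostCommutative⟶_; fromCommutativeRing)
open import Data.Empty using (⊥-elim)
open import Data.Maybe using (Maybe; map)
open import Data.Nat as ℕ using (ℕ; zero; suc; _∸_; _≤_; _<_; z≤n; s≤s)
open import Data.Nat.Induction using (<-rec)
import Data.Nat.Properties as ℕ
open import Data.Product using (_×_; Σ; _,_)
open import Data.Product.Properties using (≡-dec)
open import Data.Sum using (inj₁; inj₂)
open import Function using (_∘_)
open import Relation.Binary.PropositionalEquality as ≡ using (_≡_; _≢_)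
import Relation.Binary.Reasoning.Setoid as SetoidReasoning
open import Relation.Nullary using (¬_; yes; no)
open import Relation.Nullary.Decidable using (dec⇒maybe)

-- The standard library's ring solver needs a coefficient ring with computable
-- arithmetic.  We use the integers as pairs (m , n) standing for m - n, kept
-- normalised (one side 0), so that equal coefficients are syntactically equal.
module CommutativeRingSolver {c ℓ} (R : CommutativeRing c ℓ) where
  open CommutativeRing R
  open SetoidReasoning setoid
  open RingProperties ring
    using (-‿distribˡ-*; -‿distribʳ-*; -‿+-comm; -‿involutive; ⁻¹-anti-homo‿-; -0#≈0#)
  open import Algebra.Properties.Semiring.Mult semiring
    using (×-homo-+; ×1-homo-*) renaming (_×_ to _×′_)
  open import Algebra.Properties.CommutativeSemigroup +-commutativeSemigroup
    using (interchange)
  import Algebra.Solver.Ring.NaturalCoefficients.Default commutativeSemiring as SemiringSolver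

  normalise : ℕ → ℕ → ℕ × ℕ
  normalise m n = m ∸ n , n ∸ m

  ℤ-rawRing : RawRing _ _
  ℤ-rawRing = record
    { Carrier = ℕ × ℕ
    ; _≈_     = _≡_
    ; _+_     = λ { (a , b) (c , d) → normalise (a ℕ.+ c) (b ℕ.+ d) }
    ; _*_     = λ { (a , b) (c , d) → normalise (a ℕ.* c ℕ.+ b ℕ.* d) (a ℕ.* d ℕ.+ b ℕ.* c) }
    ; -_      = λ { (a , b) → b , a }
    ; 0#      = 0 , 0
    ; 1#      = 1 , 0
    }

  ⟦_⟧ : ℕ × ℕ → Carrier
  ⟦ m , n ⟧ = m ×′ 1# - n ×′ 1#

  x+y-[x+z]≈y-z : ∀ x y z → (x + y) - (x + z) ≈ y - z
  x+y-[x+z]≈y-z x y z = begin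
    (x + y) - (x + z)     ≈⟨ +-congˡ (sym (-‿+-comm x z)) ⟩
    (x + y) + (- x + - z) ≈⟨ interchange x y (- x) (- z) ⟩
    (x - x) + (y - z)     ≈⟨ +-congʳ (-‿inverseʳ x) ⟩
    0# + (y - z)          ≈⟨ +-identityˡ _ ⟩
    y - z                 ∎

  ⟦k+m,k+n⟧≈⟦m,n⟧ : ∀ k m n → ⟦ k ℕ.+ m , k ℕ.+ n ⟧ ≈ ⟦ m , n ⟧
  ⟦k+m,k+n⟧≈⟦m,n⟧ k m n =
    trans (+-cong (×-homo-+ 1# k m) (-‿cong (×-homo-+ 1# k n))) (x+y-[x+z]≈y-z _ _ _)

  ⟦normalise⟧ : ∀ m n → ⟦ normalise m n ⟧ ≈ ⟦ m , n ⟧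
  ⟦normalise⟧ m n with ℕ.≤-total n m
  ... | inj₁ n≤m = begin
    ⟦ m ∸ n , n ∸ m ⟧           ≡⟨ ≡.cong (λ k → ⟦ m ∸ n , k ⟧) (ℕ.m≤n⇒m∸n≡0 n≤m) ⟩
    ⟦ m ∸ n , 0 ⟧               ≈⟨ sym (⟦k+m,k+n⟧≈⟦m,n⟧ n (m ∸ n) 0) ⟩
    ⟦ n ℕ.+ (m ∸ n) , n ℕ.+ 0 ⟧ ≡⟨ ≡.cong₂ (λ a b → ⟦ a , b ⟧) (ℕ.m+[n∸m]≡n n≤m) (ℕ.+-identityʳ n) ⟩
    ⟦ m , n ⟧                   ∎
  ... | inj₂ m≤n = begin
    ⟦ m ∸ n , n ∸ m ⟧           ≡⟨ ≡.cong (λ k → ⟦ k , n ∸ m ⟧) (ℕ.m≤n⇒m∸n≡0 m≤n) ⟩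
    ⟦ 0 , n ∸ m ⟧               ≈⟨ sym (⟦k+m,k+n⟧≈⟦m,n⟧ m 0 (n ∸ m)) ⟩
    ⟦ m ℕ.+ 0 , m ℕ.+ (n ∸ m) ⟧ ≡⟨ ≡.cong₂ (λ a b → ⟦ a , b ⟧) (ℕ.+-identityʳ m) (ℕ.m+[n∸m]≡n m≤n) ⟩
    ⟦ m , n ⟧                   ∎

  -x*-y≈x*y : ∀ x y → (- x) * (- y) ≈ x * y
  -x*-y≈x*y x y = begin
    (- x) * (- y)  ≈⟨ sym (-‿distribˡ-* x (- y)) ⟩
    - (x * - y)    ≈⟨ -‿cong (sym (-‿distribʳ-* x y)) ⟩
    - (- (x * y))  ≈⟨ -‿involutive _ ⟩
    x * y          ∎

  [x-y][z-w]≈xz+yw-[xw+yz] : ∀ x y z w → (x - y) * (z - w) ≈ (x * z + y * w) - (x * w + y * z)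
  [x-y][z-w]≈xz+yw-[xw+yz] x y z w = begin
    (x - y) * (z - w)
      ≈⟨ solve 4 (λ a b c d → (a :+ b) :* (c :+ d) := (a :* c :+ b :* d) :+ (a :* d :+ b :* c))
           refl x (- y) z (- w) ⟩
    (x * z + (- y) * (- w)) + (x * - w + (- y) * z)
      ≈⟨ +-cong (+-congˡ (-x*-y≈x*y y w)) (+-cong (sym (-‿distribʳ-* x w)) (sym (-‿distribˡ-* y z))) ⟩
    (x * z + y * w) + (- (x * w) + - (y * z)) ≈⟨ +-congˡ (-‿+-comm _ _) ⟩
    (x * z + y * w) - (x * w + y * z)         ∎
    where open SemiringSolver using (solve; _:+_; _:*_; _:=_)

  ⟦⟧-homomorphism : ℤ-rawRing -Raw-AlmostCommutative⟶ fromCommutativeRing R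
  ⟦⟧-homomorphism = record
    { ⟦_⟧    = ⟦_⟧
    ; +-homo = λ { (a , b) (c , d) → begin
        ⟦ normalise (a ℕ.+ c) (b ℕ.+ d) ⟧ ≈⟨ ⟦normalise⟧ (a ℕ.+ c) (b ℕ.+ d) ⟩
        ⟦ a ℕ.+ c , b ℕ.+ d ⟧             ≈⟨ +-cong (×-homo-+ 1# a c) (-‿cong (×-homo-+ 1# b d)) ⟩
        (ι a + ι c) - (ι b + ι d)         ≈⟨ +-congˡ (sym (-‿+-comm _ _)) ⟩
        (ι a + ι c) + (- ι b + - ι d)     ≈⟨ interchange _ _ _ _ ⟩
        ⟦ a , b ⟧ + ⟦ c , d ⟧             ∎ }
    ; *-homo = λ { (a , b) (c , d) → begin
        ⟦ normalise (a ℕ.* c ℕ.+ b ℕ.* d) (a ℕ.* d ℕ.+ b ℕ.* c) ⟧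
          ≈⟨ ⟦normalise⟧ (a ℕ.* c ℕ.+ b ℕ.* d) (a ℕ.* d ℕ.+ b ℕ.* c) ⟩
        ⟦ a ℕ.* c ℕ.+ b ℕ.* d , a ℕ.* d ℕ.+ b ℕ.* c ⟧
          ≈⟨ +-cong (ι-+-* a c b d) (-‿cong (ι-+-* a d b c)) ⟩
        (ι a * ι c + ι b * ι d) - (ι a * ι d + ι b * ι c)
          ≈⟨ sym ([x-y][z-w]≈xz+yw-[xw+yz] _ _ _ _) ⟩
        ⟦ a , b ⟧ * ⟦ c , d ⟧ ∎ }
    ; -‿homo = λ { (a , b) → sym (⁻¹-anti-homo‿- (ι a) (ι b)) }
    ; 0-homo = -‿inverseʳ 0#
    ; 1-homo = trans (+-cong (+-identityʳ 1#) -0#≈0#) (+-identityʳ 1#)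
    }
    where
    ι : ℕ → Carrier
    ι n = n ×′ 1#
    ι-+-* : ∀ a c b d → ι (a ℕ.* c ℕ.+ b ℕ.* d) ≈ ι a * ι c + ι b * ι d
    ι-+-* a c b d = trans (×-homo-+ 1# (a ℕ.* c) (b ℕ.* d)) (+-cong (×1-homo-* a c) (×1-homo-* b d))

  ⟦⟧-equal? : ∀ x y → Maybe (⟦ x ⟧ ≈ ⟦ y ⟧)
  ⟦⟧-equal? x y = map (λ { ≡.refl → refl }) (dec⇒maybe (≡-dec ℕ._≟_ ℕ._≟_ x y))

  open import Algebra.Solver.Ring ℤ-rawRing (fromCommutativeRing R) ⟦⟧-homomorphism ⟦⟧-equal?
    public using (solve; _:+_; _:*_; _:-_; :-_; _:=_)

module PowerSeries {c ℓ} (F : CommutativeRing c ℓ) where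
  open FPS F
  open SetoidReasoning setoid
  open RingProperties ring using (-‿distribˡ-*; -‿+-comm; -0#≈0#)
  open import Algebra.Properties.CommutativeSemigroup +-commutativeSemigroup
    using (interchange)

  Σ<-cong : ∀ n {f g : ℕ → Carrier} → (∀ i → i < n → f i ≈ g i) → Σ< n f ≈ Σ< n g
  Σ<-cong zero    f≈g = refl
  Σ<-cong (suc n) f≈g = +-cong (Σ<-cong n (λ i i<n → f≈g i (ℕ.m<n⇒m<1+n i<n))) (f≈g n (ℕ.n<1+n n))

  Σ<-cong′ : ∀ n {f g : ℕ → Carrier} → (∀ i → f i ≈ g i) → Σ< n f ≈ Σ< n g
  Σ<-cong′ n f≈g = Σ<-cong n (λ i _ → f≈g i)

  Σ<-zero : ∀ n {f : ℕ → Carrier} → (∀ i → i < n → f i ≈ 0#) → Σ< n f ≈ 0#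
  Σ<-zero n f≈0 = trans (Σ<-cong n f≈0) (zeros n)
    where
    zeros : ∀ n → Σ< n (λ _ → 0#) ≈ 0#
    zeros zero    = refl
    zeros (suc n) = trans (+-identityʳ _) (zeros n)

  Σ<-distrib-+ : ∀ n (f g : ℕ → Carrier) → Σ< n (λ i → f i + g i) ≈ Σ< n f + Σ< n g
  Σ<-distrib-+ zero    f g = sym (+-identityˡ 0#)
  Σ<-distrib-+ (suc n) f g = trans (+-congʳ (Σ<-distrib-+ n f g)) (interchange _ _ _ _)

  *-distribˡ-Σ< : ∀ n a (f : ℕ → Carrier) → a * Σ< n f ≈ Σ< n (λ i → a * f i)
  *-distribˡ-Σ< zero    a f = zeroʳ a
  *-distribˡ-Σ< (suc n) a f = trans (distribˡ _ _ _) (+-congʳ (*-distribˡ-Σ< n a f))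

  *-distribʳ-Σ< : ∀ n a (f : ℕ → Carrier) → Σ< n f * a ≈ Σ< n (λ i → f i * a)
  *-distribʳ-Σ< n a f = trans (*-comm _ _) (trans (*-distribˡ-Σ< n a f) (Σ<-cong′ n (λ i → *-comm _ _)))

  -‿distrib-Σ< : ∀ n (f : ℕ → Carrier) → - Σ< n f ≈ Σ< n (λ i → - f i)
  -‿distrib-Σ< zero    f = -0#≈0#
  -‿distrib-Σ< (suc n) f = trans (sym (-‿+-comm _ _)) (+-congʳ (-‿distrib-Σ< n f))

  Σ<-comm : ∀ n m (f : ℕ → ℕ → Carrier) →
            Σ< n (λ i → Σ< m (f i)) ≈ Σ< m (λ j → Σ< n (λ i → f i j))
  Σ<-comm zero    m f = sym (Σ<-zero m (λ _ _ → refl))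
  Σ<-comm (suc n) m f = trans (+-congʳ (Σ<-comm n m f)) (sym (Σ<-distrib-+ m _ _))

  Σ<-head : ∀ n (f : ℕ → Carrier) → Σ< (suc n) f ≈ f 0 + Σ< n (f ∘ suc)
  Σ<-head zero    f = trans (+-identityˡ _) (sym (+-identityʳ _))
  Σ<-head (suc n) f = trans (+-congʳ (Σ<-head n f)) (+-assoc _ _ _)

  Σ<-extend : ∀ {m n} (f : ℕ → Carrier) → m ≤ n → (∀ i → m ≤ i → i < n → f i ≈ 0#) →
              Σ< n f ≈ Σ< m f
  Σ<-extend {n = zero}  f z≤n f≈0 = refl
  Σ<-extend {n = suc n} f m≤1+n f≈0 with ℕ.m≤n⇒m<n∨m≡n m≤1+n
  ... | inj₂ ≡.refl    = refl
  ... | inj₁ (s≤s m≤n) = trans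
    (+-cong (Σ<-extend f m≤n (λ i m≤i i<n → f≈0 i m≤i (ℕ.m<n⇒m<1+n i<n))) (f≈0 n m≤n (ℕ.n<1+n n)))
    (+-identityʳ _)

  δ : ℕ → ℕ → Carrier
  δ zero    zero    = 1#
  δ zero    (suc k) = 0#
  δ (suc a) zero    = 0#
  δ (suc a) (suc k) = δ a k

  δ-diag : ∀ a → δ a a ≈ 1#
  δ-diag zero    = refl
  δ-diag (suc a) = δ-diag a

  δ-≢ : ∀ {a k} → a ≢ k → δ a k ≈ 0#
  δ-≢ {zero}  {zero}  a≢k = ⊥-elim (a≢k ≡.refl)
  δ-≢ {zero}  {suc k} a≢k = refl
  δ-≢ {suc a} {zero}  a≢k = refl
  δ-≢ {suc a} {suc k} a≢k = δ-≢ (a≢k ∘ ≡.cong suc)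

  δ-> : ∀ {a k} → k < a → δ a k ≈ 0#
  δ-> = δ-≢ ∘ ℕ.>⇒≢

  δ-sym : ∀ a k → δ a k ≈ δ k a
  δ-sym zero    zero    = refl
  δ-sym zero    (suc k) = refl
  δ-sym (suc a) zero    = refl
  δ-sym (suc a) (suc k) = δ-sym a k

  δ-+ : ∀ {i n} j → i ≤ n → δ (i ℕ.+ j) n ≈ δ j (n ∸ i)
  δ-+ j z≤n       = refl
  δ-+ j (s≤s i≤n) = δ-+ j i≤n

  Σ<-δ : ∀ N a (g : ℕ → Carrier) → (N ≤ a → g a ≈ 0#) → Σ< N (λ k → δ a k * g k) ≈ g a
  Σ<-δ zero    a g g≈0 = sym (g≈0 z≤n)
  Σ<-δ (suc N) a g g≈0 with a ℕ.≟ N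
  ... | yes ≡.refl = begin
    Σ< a (λ k → δ a k * g k) + δ a a * g a
      ≈⟨ +-cong (Σ<-zero a (λ k k<a → trans (*-congʳ (δ-> k<a)) (zeroˡ _)))
                (trans (*-congʳ (δ-diag a)) (*-identityˡ _)) ⟩
    0# + g a ≈⟨ +-identityˡ _ ⟩
    g a      ∎
  ... | no a≢N = begin
    Σ< N (λ k → δ a k * g k) + δ a N * g N
      ≈⟨ +-cong (Σ<-δ N a g (λ N≤a → g≈0 (ℕ.≤∧≢⇒< N≤a (a≢N ∘ ≡.sym))))
                (trans (*-congʳ (δ-≢ a≢N)) (zeroˡ _)) ⟩
    g a + 0# ≈⟨ +-identityʳ _ ⟩
    g a      ∎

  -- Coefficient n of f ⊛ g as a sum over the whole box [0,N)², for any N > n (see ⊛≈conv).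
  -- Sums over a fixed box can be reordered freely, which reduces commutativity and
  -- associativity of ⊛ to bookkeeping.
  conv : ℕ → Series → Series → Series
  conv N f g n = Σ< N λ i → Σ< N λ j → δ (i ℕ.+ j) n * (f i * g j)

  ⊛≈conv : ∀ {N n} (f g : Series) → n < N → (f ⊛ g) n ≈ conv N f g n
  ⊛≈conv {N} {n} f g n<N = sym (begin
    conv N f g n
      ≈⟨ Σ<-extend _ n<N (λ i n<i _ → Σ<-zero N (λ j _ →
           trans (*-congʳ (δ-> (ℕ.<-≤-trans n<i (ℕ.m≤m+n i j)))) (zeroˡ _))) ⟩
    Σ< (suc n) (λ i → Σ< N (λ j → δ (i ℕ.+ j) n * (f i * g j)))
      ≈⟨ Σ<-cong (suc n) (λ i i≤n → row i (ℕ.s≤s⁻¹ i≤n)) ⟩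
    (f ⊛ g) n ∎)
    where
    row : ∀ i → i ≤ n → Σ< N (λ j → δ (i ℕ.+ j) n * (f i * g j)) ≈ f i * g (n ∸ i)
    row i i≤n = trans (Σ<-cong′ N (λ j → *-congʳ (trans (δ-+ j i≤n) (δ-sym j (n ∸ i)))))
                      (Σ<-δ N (n ∸ i) (λ j → f i * g j)
                        (λ N≤n∸i → ⊥-elim (ℕ.<⇒≱ (ℕ.≤-<-trans (ℕ.m∸n≤m n i) n<N) N≤n∸i)))

  ≋-refl : ∀ {f} → f ≋ f
  ≋-refl n = refl

  ≋-sym : ∀ {f g} → f ≋ g → g ≋ f
  ≋-sym f≋g n = sym (f≋g n)

  ≋-trans : ∀ {f g h} → f ≋ g → g ≋ h → f ≋ h
  ≋-trans f≋g g≋h n = trans (f≋g n) (g≋h n)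

  ⊛-cong : ∀ {f f′ g g′} → f ≋ f′ → g ≋ g′ → f ⊛ g ≋ f′ ⊛ g′
  ⊛-cong f≋f′ g≋g′ n = Σ<-cong′ (suc n) (λ i → *-cong (f≋f′ i) (g≋g′ (n ∸ i)))

  ⊛-comm : ∀ f g → f ⊛ g ≋ g ⊛ f
  ⊛-comm f g n = begin
    (f ⊛ g) n          ≈⟨ ⊛≈conv f g (ℕ.n<1+n n) ⟩
    conv (suc n) f g n ≈⟨ Σ<-comm (suc n) (suc n) _ ⟩
    Σ< (suc n) (λ j → Σ< (suc n) (λ i → δ (i ℕ.+ j) n * (f i * g j)))
      ≈⟨ Σ<-cong′ (suc n) (λ j → Σ<-cong′ (suc n) (λ i →
           *-cong (reflexive (≡.cong (λ k → δ k n) (ℕ.+-comm i j))) (*-comm _ _))) ⟩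
    conv (suc n) g f n ≈⟨ ⊛≈conv g f (ℕ.n<1+n n) ⟨
    (g ⊛ f) n          ∎

  conv₃ : ℕ → Series → Series → Series → Series
  conv₃ N f g h n = Σ< N λ i → Σ< N λ j → Σ< N λ k → δ (i ℕ.+ j ℕ.+ k) n * (f i * (g j * h k))

  [f⊛g]⊛h≈conv₃ : ∀ {N n} (f g h : Series) → n < N → ((f ⊛ g) ⊛ h) n ≈ conv₃ N f g h n
  [f⊛g]⊛h≈conv₃ {N} {n} f g h n<N = begin
    ((f ⊛ g) ⊛ h) n
      ≈⟨ ⊛≈conv (f ⊛ g) h n<N ⟩
    Σ< N (λ m → Σ< N (λ k → δ (m ℕ.+ k) n * ((f ⊛ g) m * h k)))
      ≈⟨ Σ<-cong N (λ m m<N → Σ<-cong′ N (λ k → *-congˡ (*-congʳ (⊛≈conv f g m<N)))) ⟩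
    Σ< N (λ m → Σ< N (λ k → δ (m ℕ.+ k) n * (conv N f g m * h k)))
      ≈⟨ Σ<-cong′ N (λ m → Σ<-cong′ N (λ k → pull m k)) ⟩
    Σ< N (λ m → Σ< N (λ k → Σ< N (λ i → Σ< N (λ j → T i j k m))))
      ≈⟨ Σ<-cong′ N (λ m → trans (Σ<-comm N N _) (Σ<-cong′ N (λ i → Σ<-comm N N _))) ⟩
    Σ< N (λ m → Σ< N (λ i → Σ< N (λ j → Σ< N (λ k → T i j k m))))
      ≈⟨ trans (Σ<-comm N N _) (Σ<-cong′ N (λ i → trans (Σ<-comm N N _) (Σ<-cong′ N (λ j → Σ<-comm N N _)))) ⟩
    Σ< N (λ i → Σ< N (λ j → Σ< N (λ k → Σ< N (λ m → T i j k m))))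
      ≈⟨ Σ<-cong′ N (λ i → Σ<-cong′ N (λ j → Σ<-cong′ N (λ k → sift i j k))) ⟩
    conv₃ N f g h n ∎
    where
    open CommutativeRingSolver F using (solve; _:*_; _:=_)
    T : ℕ → ℕ → ℕ → ℕ → Carrier
    T i j k m = (δ (i ℕ.+ j) m * δ (m ℕ.+ k) n) * (f i * (g j * h k))
    pull : ∀ m k → δ (m ℕ.+ k) n * (conv N f g m * h k) ≈ Σ< N (λ i → Σ< N (λ j → T i j k m))
    pull m k = begin
      δ (m ℕ.+ k) n * (conv N f g m * h k)
        ≈⟨ *-congˡ (*-distribʳ-Σ< N _ _) ⟩
      δ (m ℕ.+ k) n * Σ< N (λ i → Σ< N (λ j → δ (i ℕ.+ j) m * (f i * g j)) * h k)
        ≈⟨ *-distribˡ-Σ< N _ _ ⟩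
      Σ< N (λ i → δ (m ℕ.+ k) n * (Σ< N (λ j → δ (i ℕ.+ j) m * (f i * g j)) * h k))
        ≈⟨ Σ<-cong′ N (λ i → trans (*-congˡ (*-distribʳ-Σ< N _ _)) (*-distribˡ-Σ< N _ _)) ⟩
      Σ< N (λ i → Σ< N (λ j → δ (m ℕ.+ k) n * ((δ (i ℕ.+ j) m * (f i * g j)) * h k)))
        ≈⟨ Σ<-cong′ N (λ i → Σ<-cong′ N (λ j →
             solve 5 (λ d e a b c → d :* ((e :* (a :* b)) :* c) := (e :* d) :* (a :* (b :* c)))
               refl _ _ _ _ _)) ⟩
      Σ< N (λ i → Σ< N (λ j → T i j k m)) ∎
    sift : ∀ i j k → Σ< N (T i j k) ≈ δ (i ℕ.+ j ℕ.+ k) n * (f i * (g j * h k))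
    sift i j k = trans (sym (*-distribʳ-Σ< N _ _)) (*-congʳ (Σ<-δ N (i ℕ.+ j) (λ m → δ (m ℕ.+ k) n)
      (λ N≤i+j → δ-> (ℕ.<-≤-trans n<N (ℕ.≤-trans N≤i+j (ℕ.m≤m+n (i ℕ.+ j) k))))))

  conv₃-rotate : ∀ N (f g h : Series) n → conv₃ N f g h n ≈ conv₃ N g h f n
  conv₃-rotate N f g h n = trans (trans (Σ<-comm N N _) (Σ<-cong′ N (λ j → Σ<-comm N N _)))
    (Σ<-cong′ N (λ j → Σ<-cong′ N (λ k → Σ<-cong′ N (λ i →
      *-cong (reflexive (≡.cong (λ a → δ a n) (rotate i j k))) (*-rotate (f i) (g j) (h k))))))
    where
    rotate : ∀ i j k → i ℕ.+ j ℕ.+ k ≡ j ℕ.+ k ℕ.+ i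
    rotate i j k = ≡.trans (ℕ.+-assoc i j k) (ℕ.+-comm i (j ℕ.+ k))
    *-rotate : ∀ x y z → x * (y * z) ≈ y * (z * x)
    *-rotate x y z = trans (*-comm x (y * z)) (*-assoc y z x)

  ⊛-assoc : ∀ f g h → (f ⊛ g) ⊛ h ≋ f ⊛ (g ⊛ h)
  ⊛-assoc f g h n = begin
    ((f ⊛ g) ⊛ h) n        ≈⟨ [f⊛g]⊛h≈conv₃ f g h (ℕ.n<1+n n) ⟩
    conv₃ (suc n) f g h n  ≈⟨ conv₃-rotate (suc n) f g h n ⟩
    conv₃ (suc n) g h f n  ≈⟨ [f⊛g]⊛h≈conv₃ g h f (ℕ.n<1+n n) ⟨
    ((g ⊛ h) ⊛ f) n        ≈⟨ ⊛-comm (g ⊛ h) f n ⟩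
    (f ⊛ (g ⊛ h)) n        ∎

  ⊛-distribˡ-⊕ : ∀ f g h → f ⊛ (g ⊕ h) ≋ f ⊛ g ⊕ f ⊛ h
  ⊛-distribˡ-⊕ f g h n = trans (Σ<-cong′ (suc n) (λ i → distribˡ _ _ _)) (Σ<-distrib-+ (suc n) _ _)

  const⊛≋· : ∀ a f → const a ⊛ f ≋ a · f
  const⊛≋· a f n = begin
    (const a ⊛ f) n                                        ≈⟨ Σ<-head n _ ⟩
    a * f n + Σ< n (λ i → const a (suc i) * f (n ∸ suc i)) ≈⟨ +-congˡ (Σ<-zero n (λ i _ → zeroˡ _)) ⟩
    a * f n + 0#                                           ≈⟨ +-identityʳ _ ⟩
    (a · f) n                                              ∎

  seriesRing : CommutativeRing c ℓ
  seriesRing = record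
    { Carrier = Series ; _≈_ = _≋_ ; _+_ = _⊕_ ; _*_ = _⊛_ ; -_ = ⊝_ ; 0# = λ _ → 0# ; 1# = const 1#
    ; isCommutativeRing = record
      { isRing = record
        { +-isAbelianGroup = record
          { isGroup = record
            { isMonoid = record
              { isSemigroup = record
                { isMagma = record
                  { isEquivalence = record { refl = ≋-refl ; sym = ≋-sym ; trans = ≋-trans }
                  ; ∙-cong = λ f≋f′ g≋g′ n → +-cong (f≋f′ n) (g≋g′ n) }
                ; assoc = λ f g h n → +-assoc _ _ _ }
              ; identity = (λ f n → +-identityˡ _) , (λ f n → +-identityʳ _) }
            ; inverse = (λ f n → -‿inverseˡ _) , (λ f n → -‿inverseʳ _)
            ; ⁻¹-cong = λ f≋g n → -‿cong (f≋g n) }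
          ; comm = λ f g n → +-comm _ _ }
        ; *-cong = ⊛-cong
        ; *-assoc = ⊛-assoc
        ; *-identity = ⊛-identityˡ , λ f → ≋-trans (⊛-comm f (const 1#)) (⊛-identityˡ f)
        ; distrib = ⊛-distribˡ-⊕ , λ f g h → ≋-trans (⊛-comm (g ⊕ h) f)
            (≋-trans (⊛-distribˡ-⊕ f g h) (λ n → +-cong (⊛-comm f g n) (⊛-comm f h n))) }
      ; *-comm = ⊛-comm } }
    where
    ⊛-identityˡ : ∀ f → const 1# ⊛ f ≋ f
    ⊛-identityˡ f n = trans (const⊛≋· 1# f n) (*-identityˡ _)

  module S = CommutativeRing seriesRing

  X≋δ1 : X ≋ δ 1
  X≋δ1 zero          = refl
  X≋δ1 (suc zero)    = refl
  X≋δ1 (suc (suc k)) = refl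

  X⊛-zero : ∀ f → (X ⊛ f) 0 ≈ 0#
  X⊛-zero f = trans (+-identityˡ _) (zeroˡ _)

  X⊛-suc : ∀ f n → (X ⊛ f) (suc n) ≈ f n
  X⊛-suc f n = trans (Σ<-cong′ (suc (suc n)) (λ i → *-congʳ (X≋δ1 i)))
                     (Σ<-δ (suc (suc n)) 1 (λ i → f (suc n ∸ i)) (λ { (s≤s ()) }))

  divX : Series → Series
  divX g n = g (suc n)

  X⊛divX : ∀ {g} → g 0 ≈ 0# → X ⊛ divX g ≋ g
  X⊛divX {g} g₀≈0 zero    = trans (X⊛-zero (divX g)) (sym g₀≈0)
  X⊛divX {g} g₀≈0 (suc n) = X⊛-suc (divX g) n

  pow-cong : ∀ {f g} → f ≋ g → ∀ k → pow f k ≋ pow g k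
  pow-cong f≋g zero    = ≋-refl
  pow-cong f≋g (suc k) = ⊛-cong f≋g (pow-cong f≋g k)

  pow-+ : ∀ g a b → pow g (a ℕ.+ b) ≋ pow g a ⊛ pow g b
  pow-+ g zero    b = ≋-sym (S.*-identityˡ (pow g b))
  pow-+ g (suc a) b = ≋-trans (⊛-cong ≋-refl (pow-+ g a b)) (≋-sym (⊛-assoc g (pow g a) (pow g b)))

  pow-X : ∀ k n → pow X k n ≈ δ k n
  pow-X zero    zero    = refl
  pow-X zero    (suc n) = refl
  pow-X (suc k) zero    = X⊛-zero (pow X k)
  pow-X (suc k) (suc n) = trans (X⊛-suc (pow X k) n) (pow-X k n)

  pow-vanish : ∀ {g} → g 0 ≈ 0# → ∀ {k n} → n < k → pow g k n ≈ 0#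
  pow-vanish {g} g₀≈0 {suc k} {n} n<1+k = begin
    (g ⊛ pow g k) n
      ≈⟨ Σ<-head n _ ⟩
    g 0 * pow g k n + Σ< n (λ i → g (suc i) * pow g k (n ∸ suc i))
      ≈⟨ +-cong (trans (*-congʳ g₀≈0) (zeroˡ _)) (Σ<-zero n (λ i i<n →
           trans (*-congˡ (pow-vanish g₀≈0 (ℕ.<-≤-trans (ℕ.∸-monoʳ-< ℕ.z<s i<n) (ℕ.s≤s⁻¹ n<1+k))))
                 (zeroʳ _))) ⟩
    0# + 0# ≈⟨ +-identityˡ 0# ⟩
    0#      ∎

  ∘ₛ-truncate : ∀ {g} → g 0 ≈ 0# → ∀ f {N n} → n < N → (f ∘ₛ g) n ≈ Σ< N (λ k → f k * pow g k n)
  ∘ₛ-truncate g₀≈0 f n<N =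
    sym (Σ<-extend _ n<N (λ k n<k _ → trans (*-congˡ (pow-vanish g₀≈0 n<k)) (zeroʳ _)))

  ∘ₛ-congˡ : ∀ {f f′} g → f ≋ f′ → f ∘ₛ g ≋ f′ ∘ₛ g
  ∘ₛ-congˡ g f≋f′ n = Σ<-cong′ (suc n) (λ k → *-congʳ (f≋f′ k))

  ∘ₛ-congʳ : ∀ f {g g′} → g ≋ g′ → f ∘ₛ g ≋ f ∘ₛ g′
  ∘ₛ-congʳ f g≋g′ n = Σ<-cong′ (suc n) (λ k → *-congˡ (pow-cong g≋g′ k n))

  ∘ₛ-distribʳ-⊕ : ∀ f f′ g → (f ⊕ f′) ∘ₛ g ≋ (f ∘ₛ g) ⊕ (f′ ∘ₛ g)
  ∘ₛ-distribʳ-⊕ f f′ g n = trans (Σ<-cong′ (suc n) (λ k → distribʳ _ _ _)) (Σ<-distrib-+ (suc n) _ _)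

  ∘ₛ-⊝ : ∀ f g → (⊝ f) ∘ₛ g ≋ ⊝ (f ∘ₛ g)
  ∘ₛ-⊝ f g n = trans (Σ<-cong′ (suc n) (λ k → sym (-‿distribˡ-* _ _))) (sym (-‿distrib-Σ< (suc n) _))

  const-∘ₛ : ∀ a g → const a ∘ₛ g ≋ const a
  const-∘ₛ a g n = begin
    (const a ∘ₛ g) n                                     ≈⟨ Σ<-head n _ ⟩
    a * const 1# n + Σ< n (λ k → 0# * pow g (suc k) n) ≈⟨ +-congˡ (Σ<-zero n (λ _ _ → zeroˡ _)) ⟩
    a * const 1# n + 0#                                  ≈⟨ +-identityʳ _ ⟩
    a * const 1# n                                       ≈⟨ const⊛≋· a (const 1#) n ⟨
    (const a ⊛ const 1#) n                               ≈⟨ S.*-identityʳ (const a) n ⟩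
    const a n                                            ∎

  X-∘ₛ : ∀ {g} → g 0 ≈ 0# → X ∘ₛ g ≋ g
  X-∘ₛ {g} g₀≈0 n = begin
    (X ∘ₛ g) n                           ≈⟨ Σ<-cong′ (suc n) (λ k → *-congʳ (X≋δ1 k)) ⟩
    Σ< (suc n) (λ k → δ 1 k * pow g k n) ≈⟨ Σ<-δ (suc n) 1 (λ k → pow g k n) [g¹]₀≈0 ⟩
    (g ⊛ const 1#) n                     ≈⟨ S.*-identityʳ g n ⟩
    g n                                  ∎
    where
    [g¹]₀≈0 : suc n ≤ 1 → pow g 1 n ≈ 0#
    [g¹]₀≈0 (s≤s z≤n) = trans (S.*-identityʳ g 0) g₀≈0

  ∘ₛ-X : ∀ f → f ∘ₛ X ≋ f
  ∘ₛ-X f n = begin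
    (f ∘ₛ X) n                             ≈⟨ Σ<-cong′ (suc n) (λ k → *-comm _ _) ⟩
    Σ< (suc n) (λ k → pow X k n * f k)     ≈⟨ Σ<-cong′ (suc n) (λ k → *-congʳ (trans (pow-X k n) (δ-sym k n))) ⟩
    Σ< (suc n) (λ k → δ n k * f k)         ≈⟨ Σ<-δ (suc n) n f (λ 1+n≤n → ⊥-elim (ℕ.<-irrefl ≡.refl 1+n≤n)) ⟩
    f n                                    ∎

  ∘ₛ-zero : ∀ {f} g → f 0 ≈ 0# → (f ∘ₛ g) 0 ≈ 0#
  ∘ₛ-zero g f₀≈0 = trans (+-identityˡ _) (trans (*-congʳ f₀≈0) (zeroˡ _))

  ∘ₛ⊛-coeff : ∀ {g} → g 0 ≈ 0# → ∀ f d n → ((f ∘ₛ g) ⊛ d) n ≈ Σ< (suc n) (λ k → f k * (pow g k ⊛ d) n)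
  ∘ₛ⊛-coeff {g} g₀≈0 f d n = begin
    ((f ∘ₛ g) ⊛ d) n
      ≈⟨ ⊛≈conv (f ∘ₛ g) d n<N ⟩
    Σ< N (λ a → Σ< N (λ b → δ (a ℕ.+ b) n * ((f ∘ₛ g) a * d b)))
      ≈⟨ Σ<-cong N (λ a a<N → Σ<-cong′ N (λ b → *-congˡ (*-congʳ (∘ₛ-truncate g₀≈0 f a<N)))) ⟩
    Σ< N (λ a → Σ< N (λ b → δ (a ℕ.+ b) n * (Σ< N (λ k → f k * pow g k a) * d b)))
      ≈⟨ Σ<-cong′ N (λ a → Σ<-cong′ N (λ b → pull a b)) ⟩
    Σ< N (λ a → Σ< N (λ b → Σ< N (λ k → f k * (δ (a ℕ.+ b) n * (pow g k a * d b)))))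
      ≈⟨ trans (Σ<-cong′ N (λ a → Σ<-comm N N _)) (Σ<-comm N N _) ⟩
    Σ< N (λ k → Σ< N (λ a → Σ< N (λ b → f k * (δ (a ℕ.+ b) n * (pow g k a * d b)))))
      ≈⟨ Σ<-cong′ N (λ k → trans (Σ<-cong′ N (λ a → sym (*-distribˡ-Σ< N _ _))) (sym (*-distribˡ-Σ< N _ _))) ⟩
    Σ< N (λ k → f k * conv N (pow g k) d n)
      ≈⟨ Σ<-cong′ N (λ k → *-congˡ (sym (⊛≈conv (pow g k) d n<N))) ⟩
    Σ< N (λ k → f k * (pow g k ⊛ d) n) ∎
    where
    open CommutativeRingSolver F using (solve; _:*_; _:=_)
    N = suc n
    n<N = ℕ.n<1+n n
    pull : ∀ a b → δ (a ℕ.+ b) n * (Σ< N (λ k → f k * pow g k a) * d b)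
                   ≈ Σ< N (λ k → f k * (δ (a ℕ.+ b) n * (pow g k a * d b)))
    pull a b = trans (*-congˡ (*-distribʳ-Σ< N _ _)) (trans (*-distribˡ-Σ< N _ _) (Σ<-cong′ N (λ k →
      solve 4 (λ e x p y → e :* ((x :* p) :* y) := x :* (e :* (p :* y))) refl _ _ _ _)))

  ∘ₛ-distribʳ-⊛ : ∀ {g} → g 0 ≈ 0# → ∀ f f′ → (f ⊛ f′) ∘ₛ g ≋ (f ∘ₛ g) ⊛ (f′ ∘ₛ g)
  ∘ₛ-distribʳ-⊛ {g} g₀≈0 f f′ n = trans lhs (sym rhs)
    where
    N = suc n
    n<N = ℕ.n<1+n n
    T : ℕ → ℕ → Carrier
    T i j = f i * (f′ j * pow g (j ℕ.+ i) n)
    rhs : ((f ∘ₛ g) ⊛ (f′ ∘ₛ g)) n ≈ Σ< N (λ i → Σ< N (λ j → T i j))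
    rhs = begin
      ((f ∘ₛ g) ⊛ (f′ ∘ₛ g)) n
        ≈⟨ ∘ₛ⊛-coeff g₀≈0 f (f′ ∘ₛ g) n ⟩
      Σ< N (λ i → f i * (pow g i ⊛ (f′ ∘ₛ g)) n)
        ≈⟨ Σ<-cong′ N (λ i → *-congˡ (trans (⊛-comm _ _ n) (∘ₛ⊛-coeff g₀≈0 f′ (pow g i) n))) ⟩
      Σ< N (λ i → f i * Σ< N (λ j → f′ j * (pow g j ⊛ pow g i) n))
        ≈⟨ Σ<-cong′ N (λ i → trans (*-distribˡ-Σ< N _ _)
             (Σ<-cong′ N (λ j → *-congˡ (*-congˡ (sym (pow-+ g j i n)))))) ⟩
      Σ< N (λ i → Σ< N (λ j → T i j)) ∎
    lhs : ((f ⊛ f′) ∘ₛ g) n ≈ Σ< N (λ i → Σ< N (λ j → T i j))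
    lhs = begin
      ((f ⊛ f′) ∘ₛ g) n
        ≈⟨ Σ<-cong N (λ m m<N → *-congʳ (⊛≈conv f f′ m<N)) ⟩
      Σ< N (λ m → conv N f f′ m * pow g m n)
        ≈⟨ Σ<-cong′ N (λ m → trans (*-distribʳ-Σ< N _ _)
             (Σ<-cong′ N (λ i → trans (*-distribʳ-Σ< N _ _) (Σ<-cong′ N (λ j → *-assoc _ _ _))))) ⟩
      Σ< N (λ m → Σ< N (λ i → Σ< N (λ j → δ (i ℕ.+ j) m * ((f i * f′ j) * pow g m n))))
        ≈⟨ trans (Σ<-comm N N _) (Σ<-cong′ N (λ i → Σ<-comm N N _)) ⟩
      Σ< N (λ i → Σ< N (λ j → Σ< N (λ m → δ (i ℕ.+ j) m * ((f i * f′ j) * pow g m n))))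
        ≈⟨ Σ<-cong′ N (λ i → Σ<-cong′ N (λ j → sift i j)) ⟩
      Σ< N (λ i → Σ< N (λ j → T i j)) ∎
      where
      sift : ∀ i j → Σ< N (λ m → δ (i ℕ.+ j) m * ((f i * f′ j) * pow g m n)) ≈ T i j
      sift i j = begin
        Σ< N (λ m → δ (i ℕ.+ j) m * ((f i * f′ j) * pow g m n))
          ≈⟨ Σ<-δ N (i ℕ.+ j) _ (λ N≤i+j → trans (*-congˡ (pow-vanish g₀≈0 (ℕ.<-≤-trans n<N N≤i+j))) (zeroʳ _)) ⟩
        (f i * f′ j) * pow g (i ℕ.+ j) n
          ≈⟨ trans (*-assoc _ _ _) (*-congˡ (*-congˡ (reflexive (≡.cong (λ k → pow g k n) (ℕ.+-comm i j))))) ⟩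
        T i j ∎

  pow-∘ₛ : ∀ {h} → h 0 ≈ 0# → ∀ g j → pow g j ∘ₛ h ≋ pow (g ∘ₛ h) j
  pow-∘ₛ h₀≈0 g zero    = const-∘ₛ 1# _
  pow-∘ₛ h₀≈0 g (suc j) = ≋-trans (∘ₛ-distribʳ-⊛ h₀≈0 g (pow g j)) (⊛-cong ≋-refl (pow-∘ₛ h₀≈0 g j))

  ∘ₛ-assoc : ∀ {g h} → g 0 ≈ 0# → h 0 ≈ 0# → ∀ f → (f ∘ₛ g) ∘ₛ h ≋ f ∘ₛ (g ∘ₛ h)
  ∘ₛ-assoc {g} {h} g₀≈0 h₀≈0 f n = begin
    ((f ∘ₛ g) ∘ₛ h) n
      ≈⟨ Σ<-cong N (λ m m<N → *-congʳ (∘ₛ-truncate g₀≈0 f m<N)) ⟩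
    Σ< N (λ m → Σ< N (λ j → f j * pow g j m) * pow h m n)
      ≈⟨ Σ<-cong′ N (λ m → trans (*-distribʳ-Σ< N _ _) (Σ<-cong′ N (λ j → *-assoc _ _ _))) ⟩
    Σ< N (λ m → Σ< N (λ j → f j * (pow g j m * pow h m n)))
      ≈⟨ Σ<-comm N N _ ⟩
    Σ< N (λ j → Σ< N (λ m → f j * (pow g j m * pow h m n)))
      ≈⟨ Σ<-cong′ N (λ j → sym (*-distribˡ-Σ< N _ _)) ⟩
    Σ< N (λ j → f j * Σ< N (λ m → pow g j m * pow h m n))
      ≈⟨ Σ<-cong′ N (λ j → *-congˡ (trans (sym (∘ₛ-truncate h₀≈0 (pow g j) n<N)) (pow-∘ₛ h₀≈0 g j n))) ⟩
    Σ< N (λ j → f j * pow (g ∘ₛ h) j n)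
      ≈⟨ ∘ₛ-truncate (∘ₛ-zero {g} h g₀≈0) f n<N ⟨
    (f ∘ₛ (g ∘ₛ h)) n ∎
    where
    N = suc n
    n<N = ℕ.n<1+n n

  const-+ : ∀ a b → const (a + b) ≋ const a ⊕ const b
  const-+ a b zero    = refl
  const-+ a b (suc n) = sym (+-identityˡ 0#)

  ·≋const⊛ : ∀ a f → a · f ≋ const a ⊛ f
  ·≋const⊛ a f = ≋-sym (const⊛≋· a f)

  ⊛-unit≋0⇒≋0 : ∀ {q e y} → q 0 * y ≈ 1# → e ⊛ q ≋ (λ _ → 0#) → e ≋ (λ _ → 0#)
  ⊛-unit≋0⇒≋0 {q} {e} {y} q₀y≈1 e⊛q≋0 = <-rec (λ n → e n ≈ 0#) step
    where
    step : ∀ n → (∀ {i} → i < n → e i ≈ 0#) → e n ≈ 0#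
    step n e<n≈0 = begin
      e n             ≈⟨ *-identityʳ _ ⟨
      e n * 1#        ≈⟨ *-congˡ q₀y≈1 ⟨
      e n * (q 0 * y) ≈⟨ *-assoc _ _ _ ⟨
      e n * q 0 * y   ≈⟨ *-congʳ eₙq₀≈0 ⟩
      0# * y          ≈⟨ zeroˡ y ⟩
      0#              ∎
      where
      eₙq₀≈0 : e n * q 0 ≈ 0#
      eₙq₀≈0 = begin
        e n * q 0            ≈⟨ *-congˡ (reflexive (≡.cong q (ℕ.n∸n≡0 n))) ⟨
        e n * q (n ∸ n)      ≈⟨ +-identityˡ _ ⟨
        0# + e n * q (n ∸ n) ≈⟨ +-congʳ (Σ<-zero n (λ i i<n → trans (*-congʳ (e<n≈0 i<n)) (zeroˡ _))) ⟨
        (e ⊛ q) n            ≈⟨ e⊛q≋0 n ⟩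
        0#                   ∎

  ⊛-cancelˡ : ∀ {g y} → g 0 ≈ 0# → g 1 * y ≈ 1# → ∀ {a b} → g ⊛ a ≋ g ⊛ b → a ≋ b
  ⊛-cancelˡ {g} g₀≈0 g₁y≈1 {a} {b} g⊛a≋g⊛b =
    SP.x∙y⁻¹≈ε⇒x≈y a b (⊛-unit≋0⇒≋0 {divX g} {a ⊖ b} g₁y≈1 [a-b]⊛divX-g≋0)
    where
    module SP = RingProperties S.ring
    open CommutativeRingSolver seriesRing using (solve; _:*_; _:=_)
    [a-b]⊛divX-g≋0 : (a ⊖ b) ⊛ divX g ≋ (λ _ → 0#)
    [a-b]⊛divX-g≋0 n = begin
      ((a ⊖ b) ⊛ divX g) n             ≈⟨ X⊛-suc ((a ⊖ b) ⊛ divX g) n ⟨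
      (X ⊛ ((a ⊖ b) ⊛ divX g)) (suc n)
        ≈⟨ solve 3 (λ x e q → x :* (e :* q) := (x :* q) :* e) ≋-refl X (a ⊖ b) (divX g) (suc n) ⟩
      ((X ⊛ divX g) ⊛ (a ⊖ b)) (suc n) ≈⟨ ⊛-cong (X⊛divX g₀≈0) (≋-refl {a ⊖ b}) (suc n) ⟩
      (g ⊛ (a ⊖ b)) (suc n)            ≈⟨ SP.x[y-z]≈xy-xz g a b (suc n) ⟩
      (g ⊛ a ⊖ g ⊛ b) (suc n)          ≈⟨ SP.x≈y⇒x∙y⁻¹≈ε g⊛a≋g⊛b (suc n) ⟩
      0#                               ∎

-- Each identity is proved by writing lhs - rhs, with the ring solver, as a combination
-- of the differences lhs - rhs of the hypotheses.
module ZSequenceAlgebra {c ℓ} (R : CommutativeRing c ℓ) where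
  open CommutativeRing R
  open SetoidReasoning setoid
  open RingProperties ring using (x≈y⇒x∙y⁻¹≈ε; x∙y⁻¹≈ε⇒x≈y; -0#≈0#)
  open CommutativeRingSolver R using (solve; _:+_; _:*_; _:-_; _:=_)

  private
    infixl 6 _+₀_ _-₀_
    infixr 7 _*₀_

    _+₀_ : ∀ {a b} → a ≈ 0# → b ≈ 0# → a + b ≈ 0#
    a≈0 +₀ b≈0 = trans (+-cong a≈0 b≈0) (+-identityʳ 0#)

    _-₀_ : ∀ {a b} → a ≈ 0# → b ≈ 0# → a - b ≈ 0#
    a≈0 -₀ b≈0 = a≈0 +₀ trans (-‿cong b≈0) -0#≈0#

    _*₀_ : ∀ k {r} → r ≈ 0# → k * r ≈ 0#
    k *₀ r≈0 = trans (*-congˡ r≈0) (zeroʳ k)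

  Z-of-sum-weighted : ∀ {z zR zS u v hb cR cS} →
    zR * (hb * u) ≈ u - cR → zS * (hb * v) ≈ v - cS →
    z * (hb * (u + v)) ≈ (u + v) - (cR + cS) →
    hb * (z * (u + v)) ≈ hb * (u * zR + v * zS)
  Z-of-sum-weighted {z} {zR} {zS} {u} {v} {hb} {cR} {cS} eR eS e = x∙y⁻¹≈ε⇒x≈y _ _ (begin
    hb * (z * (u + v)) - hb * (u * zR + v * zS)
      ≈⟨ solve 8 (λ z zR zS u v hb cR cS →
           hb :* (z :* (u :+ v)) :- hb :* (u :* zR :+ v :* zS)
           := (z :* (hb :* (u :+ v)) :- ((u :+ v) :- (cR :+ cS)))
              :- (zR :* (hb :* u) :- (u :- cR))
              :- (zS :* (hb :* v) :- (v :- cS)))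
           refl z zR zS u v hb cR cS ⟩
    (z * (hb * (u + v)) - ((u + v) - (cR + cS)))
      - (zR * (hb * u) - (u - cR))
      - (zS * (hb * v) - (v - cS))
      ≈⟨ x≈y⇒x∙y⁻¹≈ε e -₀ x≈y⇒x∙y⁻¹≈ε eR -₀ x≈y⇒x∙y⁻¹≈ε eS ⟩
    0# ∎)

  Z-of-sum-via-hb : ∀ {z zR zS u v hb cR cS} →
    zR * (hb * u) ≈ u - cR → zS * (hb * v) ≈ v - cS → z * (u + v) ≈ u * zR + v * zS →
    z * ((cR + cS) - cR * (hb * zS) - cS * (hb * zR)) ≈ (cR * zR + cS * zS) - (cR + cS) * (hb * zR * zS)
  Z-of-sum-via-hb {z} {zR} {zS} {u} {v} {hb} {cR} {cS} eR eS e = x∙y⁻¹≈ε⇒x≈y _ _ (begin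
    z * ((cR + cS) - cR * (hb * zS) - cS * (hb * zR)) - ((cR * zR + cS * zS) - (cR + cS) * (hb * zR * zS))
      ≈⟨ solve 8 (λ z zR zS u v hb cR cS →
           z :* ((cR :+ cS) :- cR :* (hb :* zS) :- cS :* (hb :* zR))
             :- ((cR :* zR :+ cS :* zS) :- (cR :+ cS) :* (hb :* zR :* zS))
           := (z :* (u :+ v) :- (u :* zR :+ v :* zS))
              :- (hb :* zR :+ hb :* zS :- hb :* zR :* (hb :* zS)) :* (z :* (u :+ v) :- (u :* zR :+ v :* zS))
              :+ ((z :- zR) :- hb :* zS :* (z :- zR)) :* (zR :* (hb :* u) :- (u :- cR))
              :+ ((z :- zS) :- hb :* zR :* (z :- zS)) :* (zS :* (hb :* v) :- (v :- cS)))
           refl z zR zS u v hb cR cS ⟩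
    (z * (u + v) - (u * zR + v * zS))
      - (hb * zR + hb * zS - hb * zR * (hb * zS)) * (z * (u + v) - (u * zR + v * zS))
      + ((z - zR) - hb * zS * (z - zR)) * (zR * (hb * u) - (u - cR))
      + ((z - zS) - hb * zR * (z - zS)) * (zS * (hb * v) - (v - cS))
      ≈⟨ x≈y⇒x∙y⁻¹≈ε e -₀ _ *₀ x≈y⇒x∙y⁻¹≈ε e
           +₀ _ *₀ x≈y⇒x∙y⁻¹≈ε eR +₀ _ *₀ x≈y⇒x∙y⁻¹≈ε eS ⟩
    0# ∎)

  Z-of-sum-via-A : ∀ {z zR zS hb cR cS A x} → x ≈ A * hb →
    z * ((cR + cS) - cR * (hb * zS) - cS * (hb * zR)) ≈ (cR * zR + cS * zS) - (cR + cS) * (hb * zR * zS) →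
    z * ((cR + cS) * A - x * (cR * zS + cS * zR)) ≈ (cR * zR + cS * zS) * A - (cR + cS) * (x * zR * zS)
  Z-of-sum-via-A {z} {zR} {zS} {hb} {cR} {cS} {A} {x} ex e = x∙y⁻¹≈ε⇒x≈y _ _ (begin
    z * ((cR + cS) * A - x * (cR * zS + cS * zR)) - ((cR * zR + cS * zS) * A - (cR + cS) * (x * zR * zS))
      ≈⟨ solve 8 (λ z zR zS hb cR cS A x →
           z :* ((cR :+ cS) :* A :- x :* (cR :* zS :+ cS :* zR))
             :- ((cR :* zR :+ cS :* zS) :* A :- (cR :+ cS) :* (x :* zR :* zS))
           := A :* (z :* ((cR :+ cS) :- cR :* (hb :* zS) :- cS :* (hb :* zR))
                     :- ((cR :* zR :+ cS :* zS) :- (cR :+ cS) :* (hb :* zR :* zS)))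
              :+ ((cR :+ cS) :* zR :* zS :- z :* (cR :* zS :+ cS :* zR)) :* (x :- A :* hb))
           refl z zR zS hb cR cS A x ⟩
    A * (z * ((cR + cS) - cR * (hb * zS) - cS * (hb * zR)) - ((cR * zR + cS * zS) - (cR + cS) * (hb * zR * zS)))
      + ((cR + cS) * zR * zS - z * (cR * zS + cS * zR)) * (x - A * hb)
      ≈⟨ _ *₀ x≈y⇒x∙y⁻¹≈ε e +₀ _ *₀ x≈y⇒x∙y⁻¹≈ε ex ⟩
    0# ∎)

module RiordanArrays {c ℓ} (F : CommutativeRing c ℓ) where
  open FPS F
  open PowerSeries F
  module ≈-Reasoning = SetoidReasoning setoid
  module ≋-Reasoning = SetoidReasoning S.setoid
  module SeriesSolver = CommutativeRingSolver seriesRing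
  open RingProperties ring using (-0#≈0#)

  h≋X⊛a∘h⇒IsASeq : ∀ {h a} → h 0 ≈ 0# → h ≋ X ⊛ (a ∘ₛ h) → ∀ d → IsASeq d h a
  h≋X⊛a∘h⇒IsASeq {h} {a} h₀≈0 h≋X⊛a∘h d r k = begin
    entry d h (suc r) (suc k)                            ≈⟨ pull-out-X (suc r) ⟩
    (X ⊛ ((a ∘ₛ h) ⊛ (d ⊛ pow h k))) (suc r)             ≈⟨ X⊛-suc ((a ∘ₛ h) ⊛ (d ⊛ pow h k)) r ⟩
    ((a ∘ₛ h) ⊛ (d ⊛ pow h k)) r                         ≈⟨ ∘ₛ⊛-coeff h₀≈0 a (d ⊛ pow h k) r ⟩
    Σ< (suc r) (λ i → a i * (pow h i ⊛ (d ⊛ pow h k)) r) ≈⟨ Σ<-cong′ (suc r) (λ i → *-congˡ (pow-shift i r)) ⟩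
    Σ< (suc r) (λ i → a i * entry d h r (k ℕ.+ i))       ∎
    where
    open ≈-Reasoning
    open SeriesSolver using (solve; _:*_; _:=_)
    pull-out-X : d ⊛ (h ⊛ pow h k) ≋ X ⊛ ((a ∘ₛ h) ⊛ (d ⊛ pow h k))
    pull-out-X = ≋-trans (⊛-cong (≋-refl {d}) (⊛-cong h≋X⊛a∘h (≋-refl {pow h k})))
      (solve 4 (λ d x w q → d :* ((x :* w) :* q) := x :* (w :* (d :* q))) ≋-refl d X (a ∘ₛ h) (pow h k))
    pow-shift : ∀ i → pow h i ⊛ (d ⊛ pow h k) ≋ d ⊛ pow h (k ℕ.+ i)
    pow-shift i = ≋-trans (solve 3 (λ p d q → p :* (d :* q) := d :* (q :* p)) ≋-refl (pow h i) d (pow h k))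
                          (⊛-cong (≋-refl {d}) (≋-sym (pow-+ h k i)))

  -- The Z-sequence characterisation d(t) = d(0) / (1 - t Z(h(t))), with the denominator cleared.
  IsZSeq⇒Z∘h⊛X⊛d≋d-d₀ : ∀ {h d z} → h 0 ≈ 0# → IsZSeq d h z → (z ∘ₛ h) ⊛ (X ⊛ d) ≋ d ⊖ const (d 0)
  IsZSeq⇒Z∘h⊛X⊛d≋d-d₀ {h} {d} {z} h₀≈0 isZSeq =
    ≋-trans (solve 3 (λ w x d → w :* (x :* d) := x :* (w :* d)) ≋-refl (z ∘ₛ h) X d) coeff
    where
    open SeriesSolver using (solve; _:*_; _:=_)
    open ≈-Reasoning
    coeff : X ⊛ ((z ∘ₛ h) ⊛ d) ≋ d ⊖ const (d 0)
    coeff zero    = trans (X⊛-zero ((z ∘ₛ h) ⊛ d)) (sym (-‿inverseʳ (d 0)))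
    coeff (suc r) = begin
      (X ⊛ ((z ∘ₛ h) ⊛ d)) (suc r)              ≈⟨ X⊛-suc ((z ∘ₛ h) ⊛ d) r ⟩
      ((z ∘ₛ h) ⊛ d) r                          ≈⟨ ∘ₛ⊛-coeff h₀≈0 z d r ⟩
      Σ< (suc r) (λ i → z i * (pow h i ⊛ d) r)  ≈⟨ Σ<-cong′ (suc r) (λ i → *-congˡ (⊛-comm (pow h i) d r)) ⟩
      Σ< (suc r) (λ i → z i * entry d h r i)    ≈⟨ isZSeq r ⟨
      entry d h (suc r) 0                       ≈⟨ S.*-identityʳ d (suc r) ⟩
      d (suc r)                                 ≈⟨ +-identityʳ _ ⟨
      d (suc r) + 0#                            ≈⟨ +-congˡ -0#≈0# ⟨
      (d ⊖ const (d 0)) (suc r)                 ∎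

  h∘hb≋X⇒h₁*hb₁≈1 : ∀ {h hb} → (h ∘ₛ hb) ≋ X → h 1 * hb 1 ≈ 1#
  h∘hb≋X⇒h₁*hb₁≈1 {h} {hb} h∘hb≋X = begin
    h 1 * hb 1            ≈⟨ *-congˡ (S.*-identityʳ hb 1) ⟨
    h 1 * pow hb 1 1      ≈⟨ +-identityˡ _ ⟨
    0# + h 1 * pow hb 1 1 ≈⟨ +-congʳ (trans (+-identityˡ _) (zeroʳ _)) ⟨
    (h ∘ₛ hb) 1           ≈⟨ h∘hb≋X 1 ⟩
    1#                    ∎
    where open ≈-Reasoning

  module CompositionalInverse {h hb} (h₀≈0 : h 0 ≈ 0#) (hb₀≈0 : hb 0 ≈ 0#)
                              (h∘hb≋X : (h ∘ₛ hb) ≋ X) (hb∘h≋X : (hb ∘ₛ h) ≋ X) where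
    module ZAlg = ZSequenceAlgebra seriesRing

    -- t / hb(t), computed as (h(t) / t) ∘ hb(t)
    A : Series
    A = divX h ∘ₛ hb

    A⊛hb≋X : A ⊛ hb ≋ X
    A⊛hb≋X = begin
      A ⊛ hb             ≈⟨ ⊛-cong (≋-refl {A}) (X-∘ₛ hb₀≈0) ⟨
      A ⊛ (X ∘ₛ hb)      ≈⟨ ∘ₛ-distribʳ-⊛ hb₀≈0 (divX h) X ⟨
      (divX h ⊛ X) ∘ₛ hb ≈⟨ ∘ₛ-congˡ hb (≋-trans (⊛-comm (divX h) X) (X⊛divX h₀≈0)) ⟩
      h ∘ₛ hb            ≈⟨ h∘hb≋X ⟩
      X                  ∎
      where open ≋-Reasoning

    A-isASeq : ∀ d → IsASeq d h A
    A-isASeq = h≋X⊛a∘h⇒IsASeq h₀≈0 (begin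
      h                         ≈⟨ X⊛divX h₀≈0 ⟨
      X ⊛ divX h                ≈⟨ ⊛-cong (≋-refl {X}) (∘ₛ-X (divX h)) ⟨
      X ⊛ (divX h ∘ₛ X)         ≈⟨ ⊛-cong (≋-refl {X}) (∘ₛ-congʳ (divX h) hb∘h≋X) ⟨
      X ⊛ (divX h ∘ₛ (hb ∘ₛ h)) ≈⟨ ⊛-cong (≋-refl {X}) (∘ₛ-assoc hb₀≈0 h₀≈0 (divX h)) ⟨
      X ⊛ (A ∘ₛ h)              ∎)
      where open ≋-Reasoning

    IsZSeq⇒Z⊛hb⊛d∘hb≋d∘hb-d₀ : ∀ {d z} → IsZSeq d h z → z ⊛ (hb ⊛ (d ∘ₛ hb)) ≋ (d ∘ₛ hb) ⊖ const (d 0)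
    IsZSeq⇒Z⊛hb⊛d∘hb≋d∘hb-d₀ {d} {z} isZSeq = begin
      z ⊛ (hb ⊛ (d ∘ₛ hb))
        ≈⟨ ⊛-cong z≋z∘h∘hb (⊛-cong (≋-sym (X-∘ₛ hb₀≈0)) (≋-refl {d ∘ₛ hb})) ⟩
      ((z ∘ₛ h) ∘ₛ hb) ⊛ ((X ∘ₛ hb) ⊛ (d ∘ₛ hb))
        ≈⟨ ⊛-cong (≋-refl {(z ∘ₛ h) ∘ₛ hb}) (∘ₛ-distribʳ-⊛ hb₀≈0 X d) ⟨
      ((z ∘ₛ h) ∘ₛ hb) ⊛ ((X ⊛ d) ∘ₛ hb)
        ≈⟨ ∘ₛ-distribʳ-⊛ hb₀≈0 (z ∘ₛ h) (X ⊛ d) ⟨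
      ((z ∘ₛ h) ⊛ (X ⊛ d)) ∘ₛ hb
        ≈⟨ ∘ₛ-congˡ hb (IsZSeq⇒Z∘h⊛X⊛d≋d-d₀ h₀≈0 isZSeq) ⟩
      (d ⊖ const (d 0)) ∘ₛ hb
        ≈⟨ ∘ₛ-distribʳ-⊕ d (⊝ const (d 0)) hb ⟩
      (d ∘ₛ hb) ⊕ ((⊝ const (d 0)) ∘ₛ hb)
        ≈⟨ S.+-congˡ (≋-trans (∘ₛ-⊝ (const (d 0)) hb) (S.-‿cong (const-∘ₛ (d 0) hb))) ⟩
      (d ∘ₛ hb) ⊖ const (d 0) ∎
      where
      open ≋-Reasoning
      z≋z∘h∘hb : z ≋ (z ∘ₛ h) ∘ₛ hb
      z≋z∘h∘hb = ≋-sym (≋-trans (∘ₛ-assoc h₀≈0 hb₀≈0 z) (≋-trans (∘ₛ-congʳ z h∘hb≋X) (∘ₛ-X z)))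

    module _ {dR dS zR zS z} (isZR : IsZSeq dR h zR) (isZS : IsZSeq dS h zS)
             (isZ : IsZSeq (dR ⊕ dS) h z) where
      open ≋-Reasoning

      private
        u v cR cS : Series
        u  = dR ∘ₛ hb
        v  = dS ∘ₛ hb
        cR = const (dR 0)
        cS = const (dS 0)

        +·≋const⊕const⊛ : ∀ f → (dR 0 + dS 0) · f ≋ (cR ⊕ cS) ⊛ f
        +·≋const⊕const⊛ f = ≋-trans (·≋const⊛ (dR 0 + dS 0) f) (⊛-cong (const-+ (dR 0) (dS 0)) (≋-refl {f}))

        eR : zR ⊛ (hb ⊛ u) ≋ u ⊖ cR
        eR = IsZSeq⇒Z⊛hb⊛d∘hb≋d∘hb-d₀ isZR

        eS : zS ⊛ (hb ⊛ v) ≋ v ⊖ cS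
        eS = IsZSeq⇒Z⊛hb⊛d∘hb≋d∘hb-d₀ isZS

        e : z ⊛ (hb ⊛ (u ⊕ v)) ≋ (u ⊕ v) ⊖ (cR ⊕ cS)
        e = begin
          z ⊛ (hb ⊛ (u ⊕ v))
            ≈⟨ S.*-congˡ (S.*-congˡ (∘ₛ-distribʳ-⊕ dR dS hb)) ⟨
          z ⊛ (hb ⊛ ((dR ⊕ dS) ∘ₛ hb))
            ≈⟨ IsZSeq⇒Z⊛hb⊛d∘hb≋d∘hb-d₀ isZ ⟩
          ((dR ⊕ dS) ∘ₛ hb) ⊖ const (dR 0 + dS 0)
            ≈⟨ S.+-cong (∘ₛ-distribʳ-⊕ dR dS hb) (S.-‿cong (const-+ (dR 0) (dS 0))) ⟩
          (u ⊕ v) ⊖ (cR ⊕ cS) ∎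

      Z-of-sum-weighted : z ⊛ (u ⊕ v) ≋ u ⊛ zR ⊕ v ⊛ zS
      Z-of-sum-weighted = ⊛-cancelˡ hb₀≈0 (trans (*-comm (hb 1) (h 1)) (h∘hb≋X⇒h₁*hb₁≈1 h∘hb≋X))
                            (ZAlg.Z-of-sum-weighted eR eS e)

      Z-of-sum-via-hb′ : z ⊛ ((cR ⊕ cS) ⊖ cR ⊛ (hb ⊛ zS) ⊖ cS ⊛ (hb ⊛ zR))
                         ≋ (cR ⊛ zR ⊕ cS ⊛ zS) ⊖ (cR ⊕ cS) ⊛ (hb ⊛ zR ⊛ zS)
      Z-of-sum-via-hb′ = ZAlg.Z-of-sum-via-hb eR eS Z-of-sum-weighted

      Z-of-sum-via-hb : z ⊛ (const (dR 0 + dS 0) ⊖ dR 0 · (hb ⊛ zS) ⊖ dS 0 · (hb ⊛ zR))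
                        ≋ dR 0 · zR ⊕ dS 0 · zS ⊖ (dR 0 + dS 0) · (hb ⊛ zR ⊛ zS)
      Z-of-sum-via-hb = begin
        z ⊛ (const (dR 0 + dS 0) ⊖ dR 0 · (hb ⊛ zS) ⊖ dS 0 · (hb ⊛ zR))
          ≈⟨ S.*-congˡ (S.+-cong (S.+-cong (const-+ (dR 0) (dS 0)) (S.-‿cong (·≋const⊛ (dR 0) (hb ⊛ zS))))
                                 (S.-‿cong (·≋const⊛ (dS 0) (hb ⊛ zR)))) ⟩
        z ⊛ ((cR ⊕ cS) ⊖ cR ⊛ (hb ⊛ zS) ⊖ cS ⊛ (hb ⊛ zR))
          ≈⟨ Z-of-sum-via-hb′ ⟩
        (cR ⊛ zR ⊕ cS ⊛ zS) ⊖ (cR ⊕ cS) ⊛ (hb ⊛ zR ⊛ zS)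
          ≈⟨ S.+-cong (S.+-cong (·≋const⊛ (dR 0) zR) (·≋const⊛ (dS 0) zS))
                      (S.-‿cong (+·≋const⊕const⊛ (hb ⊛ zR ⊛ zS))) ⟨
        dR 0 · zR ⊕ dS 0 · zS ⊖ (dR 0 + dS 0) · (hb ⊛ zR ⊛ zS) ∎

      Z-of-sum-via-A : z ⊛ ((dR 0 + dS 0) · A ⊖ X ⊛ (dR 0 · zS ⊕ dS 0 · zR))
                       ≋ (dR 0 · zR ⊕ dS 0 · zS) ⊛ A ⊖ (dR 0 + dS 0) · (X ⊛ zR ⊛ zS)
      Z-of-sum-via-A = begin
        z ⊛ ((dR 0 + dS 0) · A ⊖ X ⊛ (dR 0 · zS ⊕ dS 0 · zR))
          ≈⟨ S.*-congˡ (S.+-cong (+·≋const⊕const⊛ A)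
                                 (S.-‿cong (S.*-congˡ (S.+-cong (·≋const⊛ (dR 0) zS) (·≋const⊛ (dS 0) zR))))) ⟩
        z ⊛ ((cR ⊕ cS) ⊛ A ⊖ X ⊛ (cR ⊛ zS ⊕ cS ⊛ zR))
          ≈⟨ ZAlg.Z-of-sum-via-A {z} {zR} {zS} {hb} {cR} {cS} {A} {X} (≋-sym A⊛hb≋X) Z-of-sum-via-hb′ ⟩
        (cR ⊛ zR ⊕ cS ⊛ zS) ⊛ A ⊖ (cR ⊕ cS) ⊛ (X ⊛ zR ⊛ zS)
          ≈⟨ S.+-cong (⊛-cong (S.+-cong (·≋const⊛ (dR 0) zR) (·≋const⊛ (dS 0) zS)) (≋-refl {A}))
                      (S.-‿cong (+·≋const⊕const⊛ (X ⊛ zR ⊛ zS))) ⟨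
        (dR 0 · zR ⊕ dS 0 · zS) ⊛ A ⊖ (dR 0 + dS 0) · (X ⊛ zR ⊛ zS) ∎

theorem3p3 : ∀ {c ℓ} (F : CommutativeRing c ℓ) → let open FPS F in
    IsField →
    (dR dS h hb : Series) →
    IsRiordan dR h → IsRiordan dS h →
    ¬ (dR 0 + dS 0 ≈ 0#) →
    IsCompInverse h hb →
    (Σ Series λ A →
      (A ⊛ hb ≋ X) × IsASeq dR h A × IsASeq dS h A × IsASeq (dR ⊕ dS) h A ×
      (∀ zR zS zRS → IsZSeq dR h zR → IsZSeq dS h zS → IsZSeq (dR ⊕ dS) h zRS →
        zRS ⊛ ((dR 0 + dS 0) · A ⊖ X ⊛ (dR 0 · zS ⊕ dS 0 · zR))
          ≋ (dR 0 · zR ⊕ dS 0 · zS) ⊛ A ⊖ (dR 0 + dS 0) · (X ⊛ zR ⊛ zS))) ×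
    (∀ zR zS zRS → IsZSeq dR h zR → IsZSeq dS h zS → IsZSeq (dR ⊕ dS) h zRS →
      (zRS ⊛ (const (dR 0 + dS 0) ⊖ dR 0 · (hb ⊛ zS) ⊖ dS 0 · (hb ⊛ zR))
          ≋ dR 0 · zR ⊕ dS 0 · zS ⊖ (dR 0 + dS 0) · (hb ⊛ zR ⊛ zS)) ×
      ((zRS ∘ₛ h) ⊛ (X ⊛ (dR ⊕ dS)) ≋ (dR ⊕ dS) ⊖ const (dR 0 + dS 0)) ×
      (zRS ⊛ ((dR ∘ₛ hb) ⊕ (dS ∘ₛ hb)) ≋ (dR ∘ₛ hb) ⊛ zR ⊕ (dS ∘ₛ hb) ⊛ zS))
theorem3p3 F _ dR dS h hb (_ , h₀≈0 , _) _ _ (hb₀≈0 , h∘hb≋X , hb∘h≋X) =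
  (A , A⊛hb≋X , A-isASeq dR , A-isASeq dS , A-isASeq (dR ⊕ dS) ,
   λ _ _ _ isZR isZS isZ → Z-of-sum-via-A isZR isZS isZ) ,
  λ _ _ _ isZR isZS isZ →
    Z-of-sum-via-hb isZR isZS isZ , IsZSeq⇒Z∘h⊛X⊛d≋d-d₀ h₀≈0 isZ , Z-of-sum-weighted isZR isZS isZ
  where
  open FPS F
  open RiordanArrays F
  open CompositionalInverse h₀≈0 hb₀≈0 h∘hb≋X hb∘h≋X
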